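{- Let $G$ be a finite simple graph, $A_1,A_2$ disjoint subsets of $V(G)$, and $G^*$ the graph obtained by toggling all pairs between $A_1$ and $A_2$, with closed neighborhood matrices $N$ and $N^*$. Suppose $A_1$ is an NO set and $A_2$ is an HO set in $G$. Then for every pattern $\mathbf{p}$, $N^*\mathbf{p}=\mathbf{1}$ if and only if either ($N\mathbf{p}=\mathbf{1}$ and $\mathbf{x}_{A_2}\cdot\mathbf{p}=0$) or ($N\mathbf{p}=\overline{\mathbf{x}_{A_1}}$ and $\mathbf{x}_{A_2}\cdot\mathbf{p}=1$). Moreover, $A_1$ is NO and $A_2$ is HO in $G^*$, and $\nu(G^*)=\nu(G)$.
   Context: For a graph $H$ with vertex set $V=\{v_1,\dots,v_n\}$, $N(H)$ is the closed neighborhood matrix over $\mathbb{Z}_2$ (entry $(i,j)$ is $1$ iff $i=j$ or $v_iv_j$ is an edge), $\nu(H)=\dim\ker N(H)$. Given disjoint $A_1,A_2\subseteq V(G)$, $G^*$ is obtained from $G$ by, for every $u\in A_1$, $v\in A_2$, adding the edge $uv$ if $u,v$ are non-adjacent and removing it if they are adjacent; $N=N(G)$, $N^*=N(G^*)$. Subsets $A$ are identified with characteristic vectors $\mathbf{x}_A$; $\mathbf{x}\cdot\mathbf{y}=\mathbf{x}^t\mathbf{y}$ over $\mathbb{Z}_2$; $\mathbf{1}$ is the all-ones vector, $\overline{\mathbf{x}}:=\mathbf{x}+\mathbf{1}$. In a graph $H$ with matrix $M$: a pattern $\mathbf{p}$ solves configuration $\mathbf{c}$ if $M\mathbf{p}=\mathbf{c}$;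 $\mathbf{c}$ (or a set $A$ via $\mathbf{x}_A$) is solvable if some pattern solves it; $\mathbf{1}$ is always solvable. A set $A$ is HO if it is not solvable. For solvable $A$, $A$ is AO if $\mathbf{x}_A\cdot\mathbf{p}=1$ for all $\mathbf{p}$ with $M\mathbf{p}=\mathbf{1}$, and NO if $\mathbf{x}_A\cdot\mathbf{p}=0$ for all such $\mathbf{p}$. -}

module Defs where

open import Data.Bool using (Bool; true; false; _∧_; _∨_; _xor_; not; if_then_else_)
open import Data.Bool.Properties using (∨-comm; ∧-comm)
open import Data.Nat using (ℕ; zero; suc)
open import Data.Fin using (Fin; zero; suc; _≟_)
open import Data.Product using (Σ; _×_; _,_; ∃)
open import Relation.Nullary using (¬_; yes; no)
open import Relation.Binary.PropositionalEquality using (_≡_; refl; cong₂; sym; trans)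
open import Function using (_∘_)

-- Z₂ is Bool with xor as addition and ∧ as multiplication.
-- Vectors over Z₂ indexed by the vertex set Fin n; matrices are Fin n → Fin n → Bool.

Vec₂ : ℕ → Set
Vec₂ n = Fin n → Bool

Mat₂ : ℕ → Set
Mat₂ n = Fin n → Fin n → Bool

Σ₂ : ∀ {n} → (Fin n → Bool) → Bool
Σ₂ {zero}  f = false
Σ₂ {suc n} f = f zero xor Σ₂ (f ∘ suc)

_·_ : ∀ {n} → Vec₂ n → Vec₂ n → Bool
x · y = Σ₂ (λ j → x j ∧ y j)

_⊛_ : ∀ {n} → Mat₂ n → Vec₂ n → Vec₂ n
(M ⊛ p) i = Σ₂ (λ j → M i j ∧ p j)

_⊕_ : ∀ {n} → Vec₂ n → Vec₂ n → Vec₂ n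
(x ⊕ y) i = x i xor y i

𝟎 : ∀ {n} → Vec₂ n
𝟎 _ = false

𝟏 : ∀ {n} → Vec₂ n
𝟏 _ = true

‾_ : ∀ {n} → Vec₂ n → Vec₂ n
(‾ x) i = x i xor true

_≈_ : ∀ {n} → Vec₂ n → Vec₂ n → Set
x ≈ y = ∀ i → x i ≡ y i

record Graph (n : ℕ) : Set where
  field
    adj     : Fin n → Fin n → Bool
    adj-sym : ∀ i j → adj i j ≡ adj j i
    adj-irr : ∀ i → adj i i ≡ false
open Graph public

N : ∀ {n} → Graph n → Mat₂ n
N G i j with i ≟ j
... | yes _ = true
... | no  _ = adj G i j

-- subsets of V are identified with their characteristic vectors
Subset : ℕ → Set
Subset = Vec₂

Disjoint : ∀ {n} → Subset n → Subset n → Set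
Disjoint A₁ A₂ = ∀ i → A₁ i ∧ A₂ i ≡ false

toggleAdj : ∀ {n} → Graph n → Subset n → Subset n → Fin n → Fin n → Bool
toggleAdj G A₁ A₂ i j = adj G i j xor ((A₁ i ∧ A₂ j) ∨ (A₂ i ∧ A₁ j))

toggle : ∀ {n} (G : Graph n) (A₁ A₂ : Subset n) → Disjoint A₁ A₂ → Graph n
toggle G A₁ A₂ d = record
  { adj = toggleAdj G A₁ A₂
  ; adj-sym = λ i j → cong₂ _xor_ (adj-sym G i j) (trans (∨-comm (A₁ i ∧ A₂ j) (A₂ i ∧ A₁ j)) (cong₂ _∨_ (∧-comm (A₂ i) (A₁ j)) (∧-comm (A₁ i) (A₂ j))))
  ; adj-irr = irr }
  where
  irr : ∀ i → toggleAdj G A₁ A₂ i i ≡ false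
  irr i with adj G i i | adj-irr G i | A₁ i | A₂ i | d i
  ... | .false | refl | false | false | _ = refl
  ... | .false | refl | false | true  | _ = refl
  ... | .false | refl | true  | false | _ = refl
  ... | .false | refl | true  | true  | ()

Solves : ∀ {n} → Mat₂ n → Vec₂ n → Vec₂ n → Set
Solves M p c = (M ⊛ p) ≈ c

Solvable : ∀ {n} → Mat₂ n → Vec₂ n → Set
Solvable M c = ∃ λ p → Solves M p c

HO : ∀ {n} → Mat₂ n → Subset n → Set
HO M A = ¬ Solvable M A

AO : ∀ {n} → Mat₂ n → Subset n → Set
AO M A = Solvable M A × (∀ p → Solves M p 𝟏 → A · p ≡ true)

NO : ∀ {n} → Mat₂ n → Subset n → Set
NO M A = Solvable M A × (∀ p → Solves M p 𝟏 → A · p ≡ false)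

lincomb : ∀ {n k} → (Fin k → Vec₂ n) → (Fin k → Bool) → Vec₂ n
lincomb b c i = Σ₂ (λ r → c r ∧ b r i)

IsKerBasis : ∀ {n k} → Mat₂ n → (Fin k → Vec₂ n) → Set
IsKerBasis {n} {k} M b =
  (∀ r → (M ⊛ b r) ≈ 𝟎) ×
  (∀ (c : Fin k → Bool) → lincomb b c ≈ 𝟎 → ∀ r → c r ≡ false) ×
  (∀ v → (M ⊛ v) ≈ 𝟎 → ∃ λ (c : Fin k → Bool) → lincomb b c ≈ v)

KerDim : ∀ {n} → Mat₂ n → ℕ → Set
KerDim {n} M k = ∃ λ (b : Fin k → Vec₂ n) → IsKerBasis M b

{-# OPTIONS --safe #-}
module Submission where

-- Disjointness of A₁ and A₂ makes the toggle a rank-two update of the closed neighbourhood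
-- matrix, N* p = N p + (A₂ · p) A₁ + (A₁ · p) A₂.  Since N is symmetric with unit diagonal,
-- p · N p = 𝟏 · p; hence 𝟏 is solvable and, A₁ being NO, A₁ · v = 0 for every solution v
-- of A₁.  As A₂ is HO, the Fredholm alternative gives w ∈ ker N with A₂ · w = 1, and pairing
-- with w shows A₁ · p = 0 whenever N* p is a configuration solvable in G; this yields the
-- description of the solutions of N* p = 𝟏.  Correcting a solution of A₁ by w gives q' with
-- N q' = A₁ and A₁ · q' = A₂ · q' = 0.  The transvection τ v = v + (A₂ · v) q' is then a
-- linear involution with N* (τ v) = N v whenever A₁ · v = 0, so it exchanges ker N and
-- ker N*, and τ w witnesses that A₂ is still HO in G*.

open import Defs
open import Algebra.Bundles using (CommutativeRing; CommutativeMonoid)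
open import Data.Bool using (Bool; true; false; _∧_; _∨_; _xor_)
open import Data.Bool.Properties
  using ( ∧-comm; ∧-assoc; ∧-idem; ∧-zeroʳ; ∧-identityʳ; ∧-distribˡ-xor; ∨-identityʳ
        ; xor-assoc; xor-comm; xor-same; xor-identityʳ
        ; ∧-commutativeMonoid; xor-∧-commutativeRing)
open import Data.Fin using (Fin; zero; suc; _≟_)
open import Data.Nat using (zero; suc)
open import Data.Product using (_×_; _,_; ∃; proj₁; proj₂)
open import Data.Sum using (_⊎_; inj₁; inj₂)
open import Data.Vec.Functional using (_∷_)
open import Function using (_∘_)
open import Function.Bundles using (_⇔_; mk⇔)
open import Relation.Binary.PropositionalEquality
  using (_≡_; refl; sym; trans; cong; cong₂; module ≡-Reasoning)
open import Relation.Nullary using (yes; no)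
open import Relation.Nullary.Negation using (contradiction)

open import Algebra.Properties.CommutativeSemigroup
  (CommutativeRing.+-commutativeSemigroup xor-∧-commutativeRing)
  using (interchange)
open import Algebra.Properties.CommutativeSemigroup
  (CommutativeMonoid.commutativeSemigroup ∧-commutativeMonoid)
  using (x∙yz≈y∙xz; x∙yz≈z∙yx; x∙yz≈z∙xy)

open ≡-Reasoning

xor-cancelˡ : ∀ x y → x xor (x xor y) ≡ y
xor-cancelˡ x y = trans (sym (xor-assoc x x y)) (cong (_xor y) (xor-same x))

xor-cancelʳ : ∀ x y → (x xor y) xor y ≡ x
xor-cancelʳ x y = trans (xor-assoc x y y) (trans (cong (x xor_) (xor-same y)) (xor-identityʳ x))

xor-moveʳ : ∀ {x y z} → x xor y ≡ z → x ≡ z xor y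
xor-moveʳ {x} {y} e = trans (sym (xor-cancelʳ x y)) (cong (_xor y) e)

∨-xor-disjoint : ∀ a b c e → a ∧ c ≡ false → (a ∧ b) ∨ (c ∧ e) ≡ (a ∧ b) xor (c ∧ e)
∨-xor-disjoint false b c     e _ = refl
∨-xor-disjoint true  b false e _ = trans (∨-identityʳ b) (sym (xor-identityʳ b))
∨-xor-disjoint true  b true  e ()

_⊙_ : ∀ {n} → Bool → Vec₂ n → Vec₂ n
(a ⊙ x) i = a ∧ x i

_⊞_ : ∀ {n} → Mat₂ n → Mat₂ n → Mat₂ n
(M ⊞ M′) i j = M i j xor M′ i j

_⊗_ : ∀ {n} → Vec₂ n → Vec₂ n → Mat₂ n
(x ⊗ y) i j = x i ∧ y j

Σ₂-cong : ∀ {n} {f g : Fin n → Bool} → (∀ i → f i ≡ g i) → Σ₂ f ≡ Σ₂ g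
Σ₂-cong {zero}  h = refl
Σ₂-cong {suc n} h = cong₂ _xor_ (h zero) (Σ₂-cong (h ∘ suc))

Σ₂-zero : ∀ {n} → Σ₂ {n} 𝟎 ≡ false
Σ₂-zero {zero}  = refl
Σ₂-zero {suc n} = Σ₂-zero {n}

Σ₂-xor : ∀ {n} (f g : Fin n → Bool) → Σ₂ (λ i → f i xor g i) ≡ Σ₂ f xor Σ₂ g
Σ₂-xor {zero}  f g = refl
Σ₂-xor {suc n} f g =
  trans (cong ((f zero xor g zero) xor_) (Σ₂-xor (f ∘ suc) (g ∘ suc)))
        (interchange (f zero) (g zero) (Σ₂ (f ∘ suc)) (Σ₂ (g ∘ suc)))

Σ₂-∧ˡ : ∀ {n} a (f : Fin n → Bool) → Σ₂ (λ i → a ∧ f i) ≡ a ∧ Σ₂ f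
Σ₂-∧ˡ     true  f = refl
Σ₂-∧ˡ {n} false f = Σ₂-zero {n}

Σ₂-swap : ∀ {m n} (h : Fin m → Fin n → Bool) →
          Σ₂ (λ i → Σ₂ (h i)) ≡ Σ₂ (λ j → Σ₂ (λ i → h i j))
Σ₂-swap {zero} {n} h = sym (Σ₂-zero {n})
Σ₂-swap {suc m} h =
  trans (cong (Σ₂ (h zero) xor_) (Σ₂-swap (h ∘ suc)))
        (sym (Σ₂-xor (h zero) (λ j → Σ₂ (λ i → h (suc i) j))))

-- Over Z₂ the off-diagonal terms of a symmetric double sum cancel in pairs.
Σ₂-symmetric : ∀ {n} (h : Fin n → Fin n → Bool) → (∀ i j → h i j ≡ h j i) →
               Σ₂ (λ i → Σ₂ (h i)) ≡ Σ₂ (λ i → h i i)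
Σ₂-symmetric {zero}  h h-sym = refl
Σ₂-symmetric {suc n} h h-sym = begin
  (h zero zero xor R) xor Σ₂ (λ i → h (suc i) zero xor Σ₂ (h (suc i) ∘ suc))
    ≡⟨ cong ((h zero zero xor R) xor_) (Σ₂-xor (λ i → h (suc i) zero) _) ⟩
  (h zero zero xor R) xor (Σ₂ (λ i → h (suc i) zero) xor Σ₂ (λ i → Σ₂ (h (suc i) ∘ suc)))
    ≡⟨ cong ((h zero zero xor R) xor_)
            (cong₂ _xor_ (Σ₂-cong (λ i → h-sym (suc i) zero))
                         (Σ₂-symmetric (λ i j → h (suc i) (suc j)) (λ i j → h-sym (suc i) (suc j)))) ⟩
  (h zero zero xor R) xor (R xor D)
    ≡⟨ xor-assoc (h zero zero) R (R xor D) ⟩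
  h zero zero xor (R xor (R xor D))
    ≡⟨ cong (h zero zero xor_) (xor-cancelˡ R D) ⟩
  h zero zero xor D ∎
  where
  R = Σ₂ (h zero ∘ suc)
  D = Σ₂ (λ i → h (suc i) (suc i))

·-comm : ∀ {n} (x y : Vec₂ n) → x · y ≡ y · x
·-comm x y = Σ₂-cong (λ i → ∧-comm (x i) (y i))

·-congˡ : ∀ {n} {x y : Vec₂ n} → x ≈ y → ∀ z → x · z ≡ y · z
·-congˡ h z = Σ₂-cong (λ i → cong (_∧ z i) (h i))

·-congʳ : ∀ {n} (x : Vec₂ n) {y z : Vec₂ n} → y ≈ z → x · y ≡ x · z
·-congʳ x h = Σ₂-cong (λ i → cong (x i ∧_) (h i))

·-distribʳ-⊕ : ∀ {n} (x y z : Vec₂ n) → x · (y ⊕ z) ≡ (x · y) xor (x · z)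
·-distribʳ-⊕ x y z =
  trans (Σ₂-cong (λ i → ∧-distribˡ-xor (x i) (y i) (z i))) (Σ₂-xor (λ i → x i ∧ y i) (λ i → x i ∧ z i))

·-distribˡ-⊕ : ∀ {n} (x y z : Vec₂ n) → (x ⊕ y) · z ≡ (x · z) xor (y · z)
·-distribˡ-⊕ x y z = begin
  (x ⊕ y) · z       ≡⟨ ·-comm (x ⊕ y) z ⟩
  z · (x ⊕ y)       ≡⟨ ·-distribʳ-⊕ z x y ⟩
  (z · x) xor (z · y) ≡⟨ cong₂ _xor_ (·-comm z x) (·-comm z y) ⟩
  (x · z) xor (y · z) ∎

·-⊙ˡ : ∀ {n} a (x y : Vec₂ n) → (a ⊙ x) · y ≡ a ∧ (x · y)
·-⊙ˡ a x y = trans (Σ₂-cong (λ i → ∧-assoc a (x i) (y i))) (Σ₂-∧ˡ a (λ i → x i ∧ y i))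

·-⊙ʳ : ∀ {n} (x : Vec₂ n) a (y : Vec₂ n) → x · (a ⊙ y) ≡ a ∧ (x · y)
·-⊙ʳ x a y = trans (Σ₂-cong (λ i → x∙yz≈y∙xz (x i) a (y i))) (Σ₂-∧ˡ a (λ i → x i ∧ y i))

·-zeroʳ : ∀ {n} (x : Vec₂ n) → x · 𝟎 ≡ false
·-zeroʳ {n} x = trans (Σ₂-cong (λ i → ∧-zeroʳ (x i))) (Σ₂-zero {n})

·-lincomb : ∀ {n k} (y : Vec₂ n) (b : Fin k → Vec₂ n) c →
            y · lincomb b c ≡ Σ₂ (λ r → c r ∧ (y · b r))
·-lincomb y b c = begin
  y · lincomb b c                        ≡⟨ Σ₂-cong (λ j → sym (Σ₂-∧ˡ (y j) (λ r → c r ∧ b r j))) ⟩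
  Σ₂ (λ j → Σ₂ (λ r → y j ∧ (c r ∧ b r j))) ≡⟨ Σ₂-swap (λ j r → y j ∧ (c r ∧ b r j)) ⟩
  Σ₂ (λ r → y · (c r ⊙ b r))               ≡⟨ Σ₂-cong (λ r → ·-⊙ʳ y (c r) (b r)) ⟩
  Σ₂ (λ r → c r ∧ (y · b r))               ∎

-- (M ⊛ p) i is definitionally the dot product of the i-th row M i with p.

⊛-congˡ : ∀ {n} {M M′ : Mat₂ n} → (∀ i j → M i j ≡ M′ i j) → ∀ p → (M ⊛ p) ≈ (M′ ⊛ p)
⊛-congˡ M≡M′ p i = ·-congˡ (M≡M′ i) p

⊛-congʳ : ∀ {n} (M : Mat₂ n) {x y : Vec₂ n} → x ≈ y → (M ⊛ x) ≈ (M ⊛ y)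
⊛-congʳ M h i = ·-congʳ (M i) h

⊛-zero : ∀ {n} (M : Mat₂ n) → (M ⊛ 𝟎) ≈ 𝟎
⊛-zero M i = ·-zeroʳ (M i)

⊛-⊞ : ∀ {n} (M M′ : Mat₂ n) p → ((M ⊞ M′) ⊛ p) ≈ ((M ⊛ p) ⊕ (M′ ⊛ p))
⊛-⊞ M M′ p i = ·-distribˡ-⊕ (M i) (M′ i) p

⊛-⊗ : ∀ {n} (x y : Vec₂ n) p → ((x ⊗ y) ⊛ p) ≈ ((y · p) ⊙ x)
⊛-⊗ x y p i = trans (·-⊙ˡ (x i) y p) (∧-comm (x i) (y · p))

IsSymmetric : ∀ {n} → Mat₂ n → Set
IsSymmetric M = ∀ i j → M i j ≡ M j i

HasUnitDiagonal : ∀ {n} → Mat₂ n → Set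
HasUnitDiagonal M = ∀ i → M i i ≡ true

·-⊛-expand : ∀ {n} (x : Vec₂ n) (M : Mat₂ n) y →
             x · (M ⊛ y) ≡ Σ₂ (λ i → Σ₂ (λ j → x i ∧ (M i j ∧ y j)))
·-⊛-expand x M y = Σ₂-cong (λ i → sym (Σ₂-∧ˡ (x i) (λ j → M i j ∧ y j)))

module _ {n} {M : Mat₂ n} (M-sym : IsSymmetric M) where

  private
    summand-swap : ∀ (x y : Vec₂ n) i j → x i ∧ (M i j ∧ y j) ≡ y j ∧ (M j i ∧ x i)
    summand-swap x y i j =
      trans (x∙yz≈z∙yx (x i) (M i j) (y j)) (cong (λ m → y j ∧ (m ∧ x i)) (M-sym i j))

  ⊛-adjoint : ∀ q p → (M ⊛ q) · p ≡ q · (M ⊛ p)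
  ⊛-adjoint q p = begin
    (M ⊛ q) · p                                  ≡⟨ ·-comm (M ⊛ q) p ⟩
    p · (M ⊛ q)                                  ≡⟨ ·-⊛-expand p M q ⟩
    Σ₂ (λ i → Σ₂ (λ j → p i ∧ (M i j ∧ q j)))     ≡⟨ Σ₂-swap (λ i j → p i ∧ (M i j ∧ q j)) ⟩
    Σ₂ (λ j → Σ₂ (λ i → p i ∧ (M i j ∧ q j)))     ≡⟨ Σ₂-cong (λ j → Σ₂-cong (λ i → summand-swap p q i j)) ⟩
    Σ₂ (λ j → Σ₂ (λ i → q j ∧ (M j i ∧ p i)))     ≡⟨ sym (·-⊛-expand q M p) ⟩
    q · (M ⊛ p)                                  ∎

  ·-⊛-self : HasUnitDiagonal M → ∀ v → v · (M ⊛ v) ≡ 𝟏 · v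
  ·-⊛-self M-diag v = begin
    v · (M ⊛ v)                                   ≡⟨ ·-⊛-expand v M v ⟩
    Σ₂ (λ i → Σ₂ (λ j → v i ∧ (M i j ∧ v j)))      ≡⟨ Σ₂-symmetric _ (summand-swap v v) ⟩
    Σ₂ (λ i → v i ∧ (M i i ∧ v i))                 ≡⟨ Σ₂-cong (λ i → cong (λ m → v i ∧ (m ∧ v i)) (M-diag i)) ⟩
    Σ₂ (λ i → v i ∧ v i)                           ≡⟨ Σ₂-cong (λ i → ∧-idem (v i)) ⟩
    𝟏 · v                                         ∎

  solution-⊥-kernel : ∀ {s c w} → Solves M s c → (M ⊛ w) ≈ 𝟎 → c · w ≡ false
  solution-⊥-kernel {s} {c} {w} Ms≈c Mw≈𝟎 = begin
    c · w       ≡⟨ sym (·-congˡ Ms≈c w) ⟩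
    (M ⊛ s) · w ≡⟨ ⊛-adjoint s w ⟩
    s · (M ⊛ w) ≡⟨ ·-congʳ s Mw≈𝟎 ⟩
    s · 𝟎       ≡⟨ ·-zeroʳ s ⟩
    false       ∎

  kernel-witness⇒HO : ∀ {c w} → (M ⊛ w) ≈ 𝟎 → c · w ≡ true → HO M c
  kernel-witness⇒HO Mw≈𝟎 c·w≡true (s , Ms≈c) =
    contradiction (trans (sym c·w≡true) (solution-⊥-kernel Ms≈c Mw≈𝟎)) λ ()

  module _ (M-diag : HasUnitDiagonal M) where

    ·-solution≡·-𝟏-solution : ∀ {c v p} → Solves M v c → Solves M p 𝟏 → c · v ≡ c · p
    ·-solution≡·-𝟏-solution {c} {v} {p} Mv≈c Mp≈𝟏 = begin
      c · v       ≡⟨ sym (·-congˡ Mv≈c v) ⟩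
      (M ⊛ v) · v ≡⟨ ·-comm (M ⊛ v) v ⟩
      v · (M ⊛ v) ≡⟨ ·-⊛-self M-diag v ⟩
      𝟏 · v       ≡⟨ sym (·-congˡ Mp≈𝟏 v) ⟩
      (M ⊛ p) · v ≡⟨ ⊛-adjoint p v ⟩
      p · (M ⊛ v) ≡⟨ ·-congʳ p Mv≈c ⟩
      p · c       ≡⟨ ·-comm p c ⟩
      c · p       ∎

    ·-solution-of-complement : ∀ {c q p} → Solves M q c → Solves M p (‾ c) → c · p ≡ false
    ·-solution-of-complement {c} {q} {p} Mq≈c Mp≈c̄ = begin
      c · p                 ≡⟨ sym (·-congˡ Mq≈c p) ⟩
      (M ⊛ q) · p           ≡⟨ ⊛-adjoint q p ⟩
      q · (M ⊛ p)           ≡⟨ ·-congʳ q Mp≈c̄ ⟩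
      q · (c ⊕ 𝟏)           ≡⟨ ·-distribʳ-⊕ q c 𝟏 ⟩
      (q · c) xor (q · 𝟏)   ≡⟨ cong₂ _xor_ (trans (sym (·-congʳ q Mq≈c)) (·-⊛-self M-diag q))
                                           (·-comm q 𝟏) ⟩
      (𝟏 · q) xor (𝟏 · q)   ≡⟨ xor-same (𝟏 · q) ⟩
      false                 ∎

zero-or-separated : ∀ {m} (c : Vec₂ m) → (c ≈ 𝟎) ⊎ ∃ λ y → y · c ≡ true
zero-or-separated {zero} c = inj₁ λ ()
zero-or-separated {suc m} c with c zero in c₀≡
... | true = inj₂ ((true ∷ 𝟎) , cong (true xor_) (Σ₂-zero {m}))
... | false with zero-or-separated (c ∘ suc)
...   | inj₁ c′≈𝟎      = inj₁ λ { zero → c₀≡ ; (suc i) → c′≈𝟎 i }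
...   | inj₂ (y , y·c′) = inj₂ ((false ∷ y) , y·c′)

span-or-separated : ∀ {m k} (b : Fin k → Vec₂ m) (c : Vec₂ m) →
  (∃ λ p → lincomb b p ≈ c) ⊎ (∃ λ y → (∀ r → y · b r ≡ false) × y · c ≡ true)
span-or-separated {k = zero} b c with zero-or-separated c
... | inj₁ c≈𝟎        = inj₁ ((λ ()) , λ i → sym (c≈𝟎 i))
... | inj₂ (y , y·c) = inj₂ (y , (λ ()) , y·c)
span-or-separated {k = suc k} b c
  with span-or-separated (b ∘ suc) c | span-or-separated (b ∘ suc) (b zero ⊕ c)
... | inj₁ (p , bp≈c) | _ = inj₁ ((false ∷ p) , bp≈c)
... | inj₂ _ | inj₁ (p , bp≈b₀⊕c) =
  inj₁ ((true ∷ p) , λ i → trans (cong (b zero i xor_) (bp≈b₀⊕c i)) (xor-cancelˡ (b zero i) (c i)))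
... | inj₂ (y₁ , y₁⊥ , y₁·c) | inj₂ (y₂ , y₂⊥ , y₂·b₀⊕c) = inj₂ (combine _ refl _ refl)
  where
  y₂·b₀⊕c′ : (y₂ · b zero) xor (y₂ · c) ≡ true
  y₂·b₀⊕c′ = trans (sym (·-distribʳ-⊕ y₂ (b zero) c)) y₂·b₀⊕c

  combine : ∀ s → y₁ · b zero ≡ s → ∀ t → y₂ · b zero ≡ t →
            ∃ λ y → (∀ r → y · b r ≡ false) × y · c ≡ true
  combine false y₁·b₀ _ _ = y₁ , (λ { zero → y₁·b₀ ; (suc r) → y₁⊥ r }) , y₁·c
  combine true _ false y₂·b₀ =
    y₂ , (λ { zero → y₂·b₀ ; (suc r) → y₂⊥ r }) , trans (cong (_xor (y₂ · c)) (sym y₂·b₀)) y₂·b₀⊕c′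
  combine true y₁·b₀ true y₂·b₀ = (y₁ ⊕ y₂) , ⊥b , (begin
    (y₁ ⊕ y₂) · c              ≡⟨ ·-distribˡ-⊕ y₁ y₂ c ⟩
    (y₁ · c) xor (y₂ · c)      ≡⟨ cong₂ _xor_ (trans y₁·c (sym y₂·b₀)) refl ⟩
    (y₂ · b zero) xor (y₂ · c) ≡⟨ y₂·b₀⊕c′ ⟩
    true                       ∎)
    where
    ⊥b : ∀ r → (y₁ ⊕ y₂) · b r ≡ false
    ⊥b zero    = trans (·-distribˡ-⊕ y₁ y₂ (b zero)) (cong₂ _xor_ y₁·b₀ y₂·b₀)
    ⊥b (suc r) = trans (·-distribˡ-⊕ y₁ y₂ (b (suc r))) (cong₂ _xor_ (y₁⊥ r) (y₂⊥ r))

solvable-or-kernel-witness : ∀ {n} {M : Mat₂ n} → IsSymmetric M →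
  ∀ c → Solvable M c ⊎ ∃ λ w → (M ⊛ w) ≈ 𝟎 × c · w ≡ true
solvable-or-kernel-witness {M = M} M-sym c with span-or-separated (λ r i → M i r) c
... | inj₁ (p , Mp≈c) = inj₁ (p , λ i → trans (·-comm (M i) p) (Mp≈c i))
... | inj₂ (y , y⊥ , y·c) = inj₂ (y , My≈𝟎 , trans (·-comm c y) y·c)
  where
  My≈𝟎 : (M ⊛ y) ≈ 𝟎
  My≈𝟎 r = trans (Σ₂-cong (λ i → trans (∧-comm (M r i) (y i)) (cong (y i ∧_) (M-sym r i)))) (y⊥ r)

𝟏-solvable : ∀ {n} {M : Mat₂ n} → IsSymmetric M → HasUnitDiagonal M → Solvable M 𝟏
𝟏-solvable {M = M} M-sym M-diag with solvable-or-kernel-witness M-sym 𝟏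
... | inj₁ solvable = solvable
... | inj₂ (w , Mw≈𝟎 , 𝟏·w≡true) = contradiction (begin
  true        ≡⟨ sym 𝟏·w≡true ⟩
  𝟏 · w       ≡⟨ sym (·-⊛-self M-sym M-diag w) ⟩
  w · (M ⊛ w) ≡⟨ ·-congʳ w Mw≈𝟎 ⟩
  w · 𝟎       ≡⟨ ·-zeroʳ w ⟩
  false       ∎) λ ()

record IsLinearInvolution {n} (φ : Vec₂ n → Vec₂ n) : Set where
  field
    resp-≈     : ∀ {x y} → x ≈ y → φ x ≈ φ y
    involutive : ∀ v → φ (φ v) ≈ v
    lincomb-φ  : ∀ {k} (b : Fin k → Vec₂ n) c → lincomb (φ ∘ b) c ≈ φ (lincomb b c)

  φ-𝟎 : φ 𝟎 ≈ 𝟎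
  φ-𝟎 i = sym (lincomb-φ {zero} (λ ()) (λ ()) i)

KerDim-transport : ∀ {n} {M₁ M₂ : Mat₂ n} {φ : Vec₂ n → Vec₂ n} → IsLinearInvolution φ →
  (∀ v → (M₁ ⊛ v) ≈ 𝟎 → (M₂ ⊛ φ v) ≈ 𝟎) → (∀ v → (M₂ ⊛ v) ≈ 𝟎 → (M₁ ⊛ φ v) ≈ 𝟎) →
  ∀ {k} → KerDim M₁ k → KerDim M₂ k
KerDim-transport {M₂ = M₂} {φ = φ} φ-inv ker₁⇒ker₂ ker₂⇒ker₁ (b , b∈ker , independent , spanning) =
  (φ ∘ b) , (λ r → ker₁⇒ker₂ (b r) (b∈ker r)) , independent′ , spanning′
  where
  open IsLinearInvolution φ-inv

  independent′ : ∀ c → lincomb (φ ∘ b) c ≈ 𝟎 → ∀ r → c r ≡ false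
  independent′ c φbc≈𝟎 = independent c λ i → begin
    lincomb b c i               ≡⟨ sym (involutive (lincomb b c) i) ⟩
    φ (φ (lincomb b c)) i       ≡⟨ resp-≈ (λ j → sym (lincomb-φ b c j)) i ⟩
    φ (lincomb (φ ∘ b) c) i     ≡⟨ resp-≈ φbc≈𝟎 i ⟩
    φ 𝟎 i                       ≡⟨ φ-𝟎 i ⟩
    false                       ∎

  spanning′ : ∀ v → (M₂ ⊛ v) ≈ 𝟎 → ∃ λ c → lincomb (φ ∘ b) c ≈ v
  spanning′ v M₂v≈𝟎 with spanning (φ v) (ker₂⇒ker₁ v M₂v≈𝟎)
  ... | c , bc≈φv = c , λ i → trans (lincomb-φ b c i) (trans (resp-≈ bc≈φv i) (involutive v i))

transvection : ∀ {n} → Vec₂ n → Vec₂ n → Vec₂ n → Vec₂ n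
transvection y u v = v ⊕ ((y · v) ⊙ u)

·-transvection : ∀ {n} (x y u v : Vec₂ n) →
                 x · transvection y u v ≡ (x · v) xor ((y · v) ∧ (x · u))
·-transvection x y u v = trans (·-distribʳ-⊕ x v _) (cong ((x · v) xor_) (·-⊙ʳ x (y · v) u))

·-transvection-⊥ : ∀ {n} {x u : Vec₂ n} y v → x · u ≡ false → x · transvection y u v ≡ x · v
·-transvection-⊥ {x = x} {u} y v x·u≡false = begin
  x · transvection y u v             ≡⟨ ·-transvection x y u v ⟩
  (x · v) xor ((y · v) ∧ (x · u))    ≡⟨ cong (λ t → (x · v) xor ((y · v) ∧ t)) x·u≡false ⟩
  (x · v) xor ((y · v) ∧ false)      ≡⟨ cong ((x · v) xor_) (∧-zeroʳ (y · v)) ⟩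
  (x · v) xor false                  ≡⟨ xor-identityʳ (x · v) ⟩
  x · v                              ∎

⊛-transvection : ∀ {n} (M : Mat₂ n) y u v →
                 (M ⊛ transvection y u v) ≈ ((M ⊛ v) ⊕ ((y · v) ⊙ (M ⊛ u)))
⊛-transvection M y u v i = ·-transvection (M i) y u v

transvection-isLinearInvolution : ∀ {n} {y u : Vec₂ n} → y · u ≡ false →
                                  IsLinearInvolution (transvection y u)
transvection-isLinearInvolution {y = y} {u} y·u≡false = record
  { resp-≈     = λ x≈z i → cong₂ (λ a s → a xor (s ∧ u i)) (x≈z i) (·-congʳ y x≈z)
  ; involutive = λ v i →
      trans (cong (λ s → transvection y u v i xor (s ∧ u i)) (·-transvection-⊥ y v y·u≡false))
            (xor-cancelʳ (v i) ((y · v) ∧ u i))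
  ; lincomb-φ  = lincomb-τ
  }
  where
  lincomb-τ : ∀ {k} (b : Fin k → Vec₂ _) c →
              lincomb (transvection y u ∘ b) c ≈ transvection y u (lincomb b c)
  lincomb-τ b c i = begin
    Σ₂ (λ r → c r ∧ (b r i xor ((y · b r) ∧ u i)))
      ≡⟨ Σ₂-cong (λ r → ∧-distribˡ-xor (c r) (b r i) _) ⟩
    Σ₂ (λ r → (c r ∧ b r i) xor (c r ∧ ((y · b r) ∧ u i)))
      ≡⟨ Σ₂-xor (λ r → c r ∧ b r i) (λ r → c r ∧ ((y · b r) ∧ u i)) ⟩
    lincomb b c i xor Σ₂ (λ r → c r ∧ ((y · b r) ∧ u i))
      ≡⟨ cong (lincomb b c i xor_) (Σ₂-cong (λ r → x∙yz≈z∙xy (c r) (y · b r) (u i))) ⟩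
    lincomb b c i xor Σ₂ (λ r → u i ∧ (c r ∧ (y · b r)))
      ≡⟨ cong (lincomb b c i xor_) (Σ₂-∧ˡ (u i) (λ r → c r ∧ (y · b r))) ⟩
    lincomb b c i xor (u i ∧ Σ₂ (λ r → c r ∧ (y · b r)))
      ≡⟨ cong (λ s → lincomb b c i xor (u i ∧ s)) (sym (·-lincomb y b c)) ⟩
    lincomb b c i xor (u i ∧ (y · lincomb b c))
      ≡⟨ cong (lincomb b c i xor_) (∧-comm (u i) _) ⟩
    transvection y u (lincomb b c) i ∎

N-symmetric : ∀ {n} (G : Graph n) → IsSymmetric (N G)
N-symmetric G i j with i ≟ j | j ≟ i
... | yes _    | yes _    = refl
... | yes refl | no j≢i   = contradiction refl j≢i
... | no i≢j   | yes refl = contradiction refl i≢j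
... | no _     | no _     = adj-sym G i j

N-unitDiagonal : ∀ {n} (G : Graph n) → HasUnitDiagonal (N G)
N-unitDiagonal G i with i ≟ i
... | yes _   = refl
... | no i≢i = contradiction refl i≢i

N-toggle : ∀ {n} (G : Graph n) (A₁ A₂ : Subset n) (d : Disjoint A₁ A₂) i j →
           N (toggle G A₁ A₂ d) i j ≡ (N G ⊞ ((A₁ ⊗ A₂) ⊞ (A₂ ⊗ A₁))) i j
N-toggle G A₁ A₂ d i j with i ≟ j
... | yes refl rewrite ∧-comm (A₂ i) (A₁ i) | d i = refl
... | no _     = cong (adj G i j xor_) (∨-xor-disjoint (A₁ i) (A₂ j) (A₂ i) (A₁ j) (d i))

N-toggle-⊛ : ∀ {n} (G : Graph n) (A₁ A₂ : Subset n) (d : Disjoint A₁ A₂) p →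
  (N (toggle G A₁ A₂ d) ⊛ p) ≈ ((N G ⊛ p) ⊕ (((A₂ · p) ⊙ A₁) ⊕ ((A₁ · p) ⊙ A₂)))
N-toggle-⊛ G A₁ A₂ d p i = begin
  (N (toggle G A₁ A₂ d) ⊛ p) i
    ≡⟨ ⊛-congˡ (N-toggle G A₁ A₂ d) p i ⟩
  ((N G ⊞ ((A₁ ⊗ A₂) ⊞ (A₂ ⊗ A₁))) ⊛ p) i
    ≡⟨ ⊛-⊞ (N G) ((A₁ ⊗ A₂) ⊞ (A₂ ⊗ A₁)) p i ⟩
  (N G ⊛ p) i xor (((A₁ ⊗ A₂) ⊞ (A₂ ⊗ A₁)) ⊛ p) i
    ≡⟨ cong ((N G ⊛ p) i xor_) (trans (⊛-⊞ (A₁ ⊗ A₂) (A₂ ⊗ A₁) p i)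
                                      (cong₂ _xor_ (⊛-⊗ A₁ A₂ p i) (⊛-⊗ A₂ A₁ p i))) ⟩
  (N G ⊛ p) i xor (((A₂ · p) ∧ A₁ i) xor ((A₁ · p) ∧ A₂ i)) ∎

module Toggle {n} (G : Graph n) (A₁ A₂ : Subset n) (d : Disjoint A₁ A₂)
              (A₁-NO : NO (N G) A₁) (A₂-HO : HO (N G) A₂) where

  N* : Mat₂ n
  N* = N (toggle G A₁ A₂ d)

  N-sym : IsSymmetric (N G)
  N-sym = N-symmetric G

  N*-sym : IsSymmetric N*
  N*-sym = N-symmetric (toggle G A₁ A₂ d)

  N-diag : HasUnitDiagonal (N G)
  N-diag = N-unitDiagonal G

  q : Vec₂ n
  q = proj₁ (proj₁ A₁-NO)

  q-solves : Solves (N G) q A₁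
  q-solves = proj₂ (proj₁ A₁-NO)

  A₁⊥𝟏-solutions : ∀ p → Solves (N G) p 𝟏 → A₁ · p ≡ false
  A₁⊥𝟏-solutions = proj₂ A₁-NO

  p₀ : Vec₂ n
  p₀ = proj₁ (𝟏-solvable N-sym N-diag)

  p₀-solves : Solves (N G) p₀ 𝟏
  p₀-solves = proj₂ (𝟏-solvable N-sym N-diag)

  kernel-witness : ∃ λ w → (N G ⊛ w) ≈ 𝟎 × A₂ · w ≡ true
  kernel-witness with solvable-or-kernel-witness N-sym A₂
  ... | inj₁ solvable = contradiction solvable A₂-HO
  ... | inj₂ witness  = witness

  w : Vec₂ n
  w = proj₁ kernel-witness

  w∈ker : (N G ⊛ w) ≈ 𝟎
  w∈ker = proj₁ (proj₂ kernel-witness)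

  A₂·w≡true : A₂ · w ≡ true
  A₂·w≡true = proj₂ (proj₂ kernel-witness)

  A₁·w≡false : A₁ · w ≡ false
  A₁·w≡false = solution-⊥-kernel N-sym q-solves w∈ker

  N*-⊛ : ∀ p → A₁ · p ≡ false → (N* ⊛ p) ≈ ((N G ⊛ p) ⊕ ((A₂ · p) ⊙ A₁))
  N*-⊛ p A₁·p≡false i = begin
    (N* ⊛ p) i
      ≡⟨ N-toggle-⊛ G A₁ A₂ d p i ⟩
    (N G ⊛ p) i xor (((A₂ · p) ∧ A₁ i) xor ((A₁ · p) ∧ A₂ i))
      ≡⟨ cong (λ b → (N G ⊛ p) i xor (((A₂ · p) ∧ A₁ i) xor (b ∧ A₂ i))) A₁·p≡false ⟩
    (N G ⊛ p) i xor (((A₂ · p) ∧ A₁ i) xor false)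
      ≡⟨ cong ((N G ⊛ p) i xor_) (xor-identityʳ _) ⟩
    (N G ⊛ p) i xor ((A₂ · p) ∧ A₁ i) ∎

  N*-⊛-·w : ∀ p → (N* ⊛ p) · w ≡ A₁ · p
  N*-⊛-·w p = begin
    (N* ⊛ p) · w
      ≡⟨ ·-congˡ (N-toggle-⊛ G A₁ A₂ d p) w ⟩
    ((N G ⊛ p) ⊕ (((A₂ · p) ⊙ A₁) ⊕ ((A₁ · p) ⊙ A₂))) · w
      ≡⟨ trans (·-distribˡ-⊕ (N G ⊛ p) _ w) (cong (((N G ⊛ p) · w) xor_) (·-distribˡ-⊕ _ _ w)) ⟩
    ((N G ⊛ p) · w) xor ((((A₂ · p) ⊙ A₁) · w) xor (((A₁ · p) ⊙ A₂) · w))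
      ≡⟨ cong₂ _xor_ (solution-⊥-kernel N-sym (λ _ → refl) w∈ker)
                     (cong₂ _xor_ (·-⊙ˡ (A₂ · p) A₁ w) (·-⊙ˡ (A₁ · p) A₂ w)) ⟩
    false xor (((A₂ · p) ∧ (A₁ · w)) xor ((A₁ · p) ∧ (A₂ · w)))
      ≡⟨ cong₂ (λ s t → ((A₂ · p) ∧ s) xor ((A₁ · p) ∧ t)) A₁·w≡false A₂·w≡true ⟩
    ((A₂ · p) ∧ false) xor ((A₁ · p) ∧ true)
      ≡⟨ cong₂ _xor_ (∧-zeroʳ (A₂ · p)) (∧-identityʳ (A₁ · p)) ⟩
    A₁ · p ∎

  A₁⊥-N*-solution : ∀ {c p} → Solvable (N G) c → Solves N* p c → A₁ · p ≡ false
  A₁⊥-N*-solution {c} {p} (s , Ns≈c) N*p≈c = begin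
    A₁ · p       ≡⟨ sym (N*-⊛-·w p) ⟩
    (N* ⊛ p) · w ≡⟨ ·-congˡ N*p≈c w ⟩
    c · w        ≡⟨ solution-⊥-kernel N-sym Ns≈c w∈ker ⟩
    false        ∎

  N-solves-𝟏⊕A₁-part : ∀ p → Solves N* p 𝟏 → Solves (N G) p (𝟏 ⊕ ((A₂ · p) ⊙ A₁))
  N-solves-𝟏⊕A₁-part p N*p≈𝟏 i =
    xor-moveʳ (trans (sym (N*-⊛ p (A₁⊥-N*-solution (𝟏-solvable N-sym N-diag) N*p≈𝟏) i)) (N*p≈𝟏 i))

  N*-solution⇒ : ∀ p → Solves N* p 𝟏 →
    (Solves (N G) p 𝟏 × A₂ · p ≡ false) ⊎ (Solves (N G) p (‾ A₁) × A₂ · p ≡ true)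
  N*-solution⇒ p N*p≈𝟏 with A₂ · p | N-solves-𝟏⊕A₁-part p N*p≈𝟏
  ... | false | Np≈𝟏  = inj₁ (Np≈𝟏 , refl)
  ... | true  | Np≈Ā₁ = inj₂ ((λ i → trans (Np≈Ā₁ i) (xor-comm true (A₁ i))) , refl)

  ⇒N*-solution : ∀ p →
    (Solves (N G) p 𝟏 × A₂ · p ≡ false) ⊎ (Solves (N G) p (‾ A₁) × A₂ · p ≡ true) → Solves N* p 𝟏
  ⇒N*-solution p (inj₁ (Np≈𝟏 , A₂·p≡false)) i =
    trans (N*-⊛ p (A₁⊥𝟏-solutions p Np≈𝟏) i) (cong₂ (λ x a → x xor (a ∧ A₁ i)) (Np≈𝟏 i) A₂·p≡false)
  ⇒N*-solution p (inj₂ (Np≈Ā₁ , A₂·p≡true)) i = begin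
    (N* ⊛ p) i                        ≡⟨ N*-⊛ p A₁·p≡false i ⟩
    (N G ⊛ p) i xor ((A₂ · p) ∧ A₁ i)  ≡⟨ cong₂ (λ x a → x xor (a ∧ A₁ i)) (Np≈Ā₁ i) A₂·p≡true ⟩
    (A₁ i xor true) xor A₁ i           ≡⟨ cong (_xor A₁ i) (xor-comm (A₁ i) true) ⟩
    (true xor A₁ i) xor A₁ i           ≡⟨ xor-cancelʳ true (A₁ i) ⟩
    true                              ∎
    where
    A₁·p≡false : A₁ · p ≡ false
    A₁·p≡false = ·-solution-of-complement N-sym N-diag q-solves Np≈Ā₁

  q′ : Vec₂ n
  q′ = transvection A₂ w q

  q′-solves : Solves (N G) q′ A₁
  q′-solves i = begin
    (N G ⊛ q′) i                              ≡⟨ ⊛-transvection (N G) A₂ w q i ⟩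
    (N G ⊛ q) i xor ((A₂ · q) ∧ (N G ⊛ w) i)   ≡⟨ cong₂ (λ x t → x xor ((A₂ · q) ∧ t)) (q-solves i)
                                                                                       (w∈ker i) ⟩
    A₁ i xor ((A₂ · q) ∧ false)               ≡⟨ cong (A₁ i xor_) (∧-zeroʳ (A₂ · q)) ⟩
    A₁ i xor false                            ≡⟨ xor-identityʳ (A₁ i) ⟩
    A₁ i                                      ∎

  A₂·q′≡false : A₂ · q′ ≡ false
  A₂·q′≡false = begin
    A₂ · q′                              ≡⟨ ·-transvection A₂ A₂ w q ⟩
    (A₂ · q) xor ((A₂ · q) ∧ (A₂ · w))   ≡⟨ cong (λ t → (A₂ · q) xor ((A₂ · q) ∧ t)) A₂·w≡true ⟩
    (A₂ · q) xor ((A₂ · q) ∧ true)       ≡⟨ cong ((A₂ · q) xor_) (∧-identityʳ (A₂ · q)) ⟩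
    (A₂ · q) xor (A₂ · q)                ≡⟨ xor-same (A₂ · q) ⟩
    false                                ∎

  A₁·q′≡false : A₁ · q′ ≡ false
  A₁·q′≡false = trans (·-solution≡·-𝟏-solution N-sym N-diag q′-solves p₀-solves)
                      (A₁⊥𝟏-solutions p₀ p₀-solves)

  A₁-NO* : NO N* A₁
  A₁-NO* = (q′ , N*q′≈A₁) , λ p → A₁⊥-N*-solution (𝟏-solvable N-sym N-diag)
    where
    N*q′≈A₁ : Solves N* q′ A₁
    N*q′≈A₁ i = trans (N*-⊛ q′ A₁·q′≡false i)
                      (trans (cong₂ (λ x a → x xor (a ∧ A₁ i)) (q′-solves i) A₂·q′≡false)
                             (xor-identityʳ (A₁ i)))

  τ : Vec₂ n → Vec₂ n
  τ = transvection A₂ q′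

  τ-isLinearInvolution : IsLinearInvolution τ
  τ-isLinearInvolution = transvection-isLinearInvolution A₂·q′≡false

  open IsLinearInvolution τ-isLinearInvolution using (involutive)

  N*-τ : ∀ v → A₁ · v ≡ false → (N* ⊛ τ v) ≈ (N G ⊛ v)
  N*-τ v A₁·v≡false i = begin
    (N* ⊛ τ v) i
      ≡⟨ N*-⊛ (τ v) (trans (·-transvection-⊥ A₂ v A₁·q′≡false) A₁·v≡false) i ⟩
    (N G ⊛ τ v) i xor ((A₂ · τ v) ∧ A₁ i)
      ≡⟨ cong₂ (λ x a → x xor (a ∧ A₁ i)) (⊛-transvection (N G) A₂ q′ v i)
                                           (·-transvection-⊥ A₂ v A₂·q′≡false) ⟩
    ((N G ⊛ v) i xor ((A₂ · v) ∧ (N G ⊛ q′) i)) xor ((A₂ · v) ∧ A₁ i)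
      ≡⟨ cong (λ t → ((N G ⊛ v) i xor ((A₂ · v) ∧ t)) xor ((A₂ · v) ∧ A₁ i)) (q′-solves i) ⟩
    ((N G ⊛ v) i xor ((A₂ · v) ∧ A₁ i)) xor ((A₂ · v) ∧ A₁ i)
      ≡⟨ xor-cancelʳ ((N G ⊛ v) i) _ ⟩
    (N G ⊛ v) i ∎

  τ-ker-N⇒ker-N* : ∀ v → (N G ⊛ v) ≈ 𝟎 → (N* ⊛ τ v) ≈ 𝟎
  τ-ker-N⇒ker-N* v Nv≈𝟎 i = trans (N*-τ v (solution-⊥-kernel N-sym q-solves Nv≈𝟎) i) (Nv≈𝟎 i)

  τ-ker-N*⇒ker-N : ∀ v → (N* ⊛ v) ≈ 𝟎 → (N G ⊛ τ v) ≈ 𝟎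
  τ-ker-N*⇒ker-N v N*v≈𝟎 i = begin
    (N G ⊛ τ v) i       ≡⟨ sym (N*-τ (τ v) A₁·τv≡false i) ⟩
    (N* ⊛ τ (τ v)) i    ≡⟨ ⊛-congʳ N* (involutive v) i ⟩
    (N* ⊛ v) i          ≡⟨ N*v≈𝟎 i ⟩
    false               ∎
    where
    A₁·τv≡false : A₁ · τ v ≡ false
    A₁·τv≡false = trans (·-transvection-⊥ A₂ v A₁·q′≡false)
                        (A₁⊥-N*-solution (𝟎 , ⊛-zero (N G)) N*v≈𝟎)

  A₂-HO* : HO N* A₂
  A₂-HO* = kernel-witness⇒HO N*-sym (τ-ker-N⇒ker-N* w w∈ker)
                             (trans (·-transvection-⊥ A₂ w A₂·q′≡false) A₂·w≡true)

  KerDim-N⇔N* : ∀ k → KerDim (N G) k ⇔ KerDim N* k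
  KerDim-N⇔N* k = mk⇔ (KerDim-transport τ-isLinearInvolution τ-ker-N⇒ker-N* τ-ker-N*⇒ker-N)
                      (KerDim-transport τ-isLinearInvolution τ-ker-N*⇒ker-N τ-ker-N⇒ker-N*)

mainTheorem15 : ∀ {n} (G : Graph n) (A₁ A₂ : Subset n) (d : Disjoint A₁ A₂) →
    NO (N G) A₁ → HO (N G) A₂ →
    let N* = N (toggle G A₁ A₂ d) in
    (∀ p → Solves N* p 𝟏 ⇔
        ((Solves (N G) p 𝟏 × A₂ · p ≡ false) ⊎ (Solves (N G) p (‾ A₁) × A₂ · p ≡ true)))
    × NO N* A₁ × HO N* A₂
    × (∀ k → KerDim (N G) k ⇔ KerDim N* k)
mainTheorem15 G A₁ A₂ d A₁-NO A₂-HO =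
  (λ p → mk⇔ (N*-solution⇒ p) (⇒N*-solution p)) , A₁-NO* , A₂-HO* , KerDim-N⇔N*
  where open Toggle G A₁ A₂ d A₁-NO A₂-HO
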